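{- Let $Y$ and $W$ be row-strict composition tableaux with entries in $[n]$ (possibly of different composition shapes). Suppose that for every column index $c\ge1$, the multiset of entries in column $c$ of $Y$ equals the multiset of entries in column $c$ of $W$. Then $Y=W$ (same shape and same entries in every cell).
   Context: Let $[n]=\{1,\dots,n\}$. A composition is a finite sequence $\alpha=(\alpha_1,\dots,\alpha_l)$ of positive integers; its diagram has $\alpha_i$ left-justified cells in row $i$. A row-strict composition tableau (RSCT) of shape $\alpha$ with entries in $[n]$ is a filling $Y$ of the diagram of $\alpha$ with entries in $[n]$ such that: (1) entries strictly decrease along each row from left to right; (2) entries of the leftmost column weakly increase from top to bottom; (3) (row-strict triple rule) letting $m=\max_i\alpha_i$ and extending $Y$ by zero entries to an $l\times m$ array $\overline{Y}$, for all $1\le i<j\le l$ and $2\le k\le m$: if $\overline{Y}(j,k)>\overline{Y}(i,k)$ then $\overline{Y}(j,k)\ge\overline{Y}(i,k-1)$. -}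

module Defs where

open import Data.Nat using (ℕ; zero; suc; _≤_; _<_; _>_; _≥_)
open import Data.List using (List; []; _∷_; length; mapMaybe; map)
open import Data.Maybe using (Maybe; just; nothing)
open import Data.List.Relation.Unary.All using (All)
open import Data.List.Relation.Unary.AllPairs using (AllPairs)
open import Data.List.Relation.Unary.Linked using (Linked)
open import Data.List.Relation.Binary.Permutation.Propositional using (_↭_)

-- A filling of a composition diagram: a list of rows (top to bottom),
-- each row a list of entries (left to right).  The shape is the list of
-- row lengths; rows must be nonempty (composition parts are positive).
Filling : Set
Filling = List (List ℕ)

nth : List ℕ → ℕ → Maybe ℕ
nth []       _       = nothing
nth (x ∷ _)  zero    = just x
nth (_ ∷ xs) (suc k) = nth xs k

orZero : Maybe ℕ → ℕ
orZero (just x) = x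
orZero nothing  = 0

row : Filling → ℕ → List ℕ
row []       _       = []
row (r ∷ _)  zero    = r
row (_ ∷ rs) (suc i) = row rs i

-- zero-extended array  Ȳ(i,k)  with 0-based row index i and column index k
entry : Filling → ℕ → ℕ → ℕ
entry Y i k = orZero (nth (row Y i) k)

headOr0 : List ℕ → ℕ
headOr0 []      = 0
headOr0 (x ∷ _) = x

NonEmptyRow : List ℕ → Set
NonEmptyRow []      = Data.Empty.⊥ where import Data.Empty
NonEmptyRow (_ ∷ _) = Data.Unit.⊤ where import Data.Unit

InRange : ℕ → ℕ → Set
InRange n x = 1 ≤ x × x ≤ n
  where open import Data.Product using (_×_)

record IsRSCT (n : ℕ) (Y : Filling) : Set where
  field
    nonempty   : All NonEmptyRow Y
    inRange    : All (All (InRange n)) Y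
    rowStrict  : All (AllPairs _>_) Y
    firstCol   : AllPairs _≤_ (map headOr0 Y)
    -- (3) triple rule (0-based: column k+1 here is column k+2 of the paper,
    --     columns k ≥ 1-based 2 are exactly suc k), rows i < j
    triple     : ∀ i j k → i < j → j < length Y →
                 entry Y j (suc k) > entry Y i (suc k) →
                 entry Y j (suc k) ≥ entry Y i k

column : Filling → ℕ → List ℕ
column Y c = mapMaybe (λ r → nth r c) Y

module Submission where

-- Two row-strict composition tableaux Y, W whose columns hold the
-- same multisets agree cell by cell; we show this column by column, and within
-- a column row by row from the top.  Suppose the cells of column c agree in all
-- rows above j (and, for c > 0, column c-1 agrees everywhere), and that Y holds
-- v at (j,c) while W holds something smaller there or nothing.  Since the
-- columns are permutations of each other, v must reappear in W at some lower
-- row j' > j of column c (reappears-below).  For c = 0 this contradicts the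
-- weakly increasing first column (or nonemptiness of rows); for c > 0 the
-- triple rule applied to rows j < j' of W yields W(j,c-1) ≤ v, whereas row
-- strictness of Y gives W(j,c-1) = Y(j,c-1) > v.  Excluding such an overshoot
-- in both directions forces equality of the cells (column-agrees), and a
-- filling is determined by its cells (filling-ext).

open import Defs
open import Data.Nat using (ℕ; zero; suc; _≤_; _<_; _>_; z≤n; s≤s)
open import Data.Nat.Properties using (<-trans; <⇒≢; <⇒≱; <-cmp)
open import Data.Nat.Induction using (<-rec)
open import Data.Maybe using (Maybe; just; nothing)
open import Data.Maybe.Properties using (just-injective)
open import Data.List using (List; []; _∷_; length; map)
open import Data.List.Membership.Propositional using (_∈_)
open import Data.List.Relation.Unary.Any using (here; there)
open import Data.List.Relation.Unary.Any.Properties using (¬Any[])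
open import Data.List.Relation.Unary.All using (All; []; _∷_)
open import Data.List.Relation.Unary.AllPairs using (AllPairs; []; _∷_)
open import Data.List.Relation.Binary.Permutation.Propositional using (_↭_; ↭-sym)
open import Data.List.Relation.Binary.Permutation.Propositional.Properties using (∈-resp-↭; drop-∷)
open import Data.Product using (∃; _×_; _,_; proj₁)
open import Data.Empty using (⊥; ⊥-elim)
open import Data.Unit using (⊤; tt)
open import Relation.Binary.Definitions using (tri<; tri≈; tri>)
open import Relation.Binary.PropositionalEquality using (_≡_; _≢_; refl; sym; trans; cong; cong₂; subst)

SameCell : Filling → Filling → ℕ → ℕ → Set
SameCell X Z c i = nth (row X i) c ≡ nth (row Z i) c

SameColumn : Filling → Filling → ℕ → Set
SameColumn X Z c = ∀ i → SameCell X Z c i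

Below : Maybe ℕ → ℕ → Set
Below nothing  _ = ⊤
Below (just w) v = w < v

below-≢ : ∀ {m v} → Below m v → m ≢ just v
below-≢ w<v refl = <⇒≢ w<v refl

below-just : ∀ {m w v} → m ≡ just w → Below m v → w < v
below-just refl w<v = w<v

below-orZero : ∀ {m v} → 1 ≤ v → Below m v → orZero m < v
below-orZero {nothing} 1≤v _   = 1≤v
below-orZero {just w}  _   w<v = w<v

-- Excluding overshoots in both directions is what the row-by-row induction needs.
NoOvershoot : Filling → Filling → ℕ → ℕ → Set
NoOvershoot X Z c j =
  (∀ i → i < j → SameCell X Z c i) →
  ∀ v → nth (row X j) c ≡ just v → Below (nth (row Z j) c) v → ⊥

column-∷-just : ∀ c {v} r X → nth r c ≡ just v → column (r ∷ X) c ≡ v ∷ column X c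
column-∷-just c r X rv rewrite rv = refl

column-∷-nothing : ∀ c r X → nth r c ≡ nothing → column (r ∷ X) c ≡ column X c
column-∷-nothing c r X r∅ rewrite r∅ = refl

cell-in-column : ∀ c {v} i X → nth (row X i) c ≡ just v → v ∈ column X c
cell-in-column c i       []      ()
cell-in-column c zero    (r ∷ X) rv rewrite column-∷-just c r X rv = here refl
cell-in-column c (suc i) (r ∷ X) xv with nth r c
... | nothing = cell-in-column c i X xv
... | just _  = there (cell-in-column c i X xv)

column-cell : ∀ c {v} X → v ∈ column X c → ∃ λ i → nth (row X i) c ≡ just v
column-cell c []      ()
column-cell c (r ∷ X) v∈ with nth r c in rc
... | nothing = let (i , xv) = column-cell c X v∈ in suc i , xv
... | just _ with v∈
...   | here refl = zero , rc
...   | there v∈′ = let (i , xv) = column-cell c X v∈′ in suc i , xv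

in-column-below-top : ∀ c {v} X → v ∈ column X c → nth (row X 0) c ≢ just v →
                      ∃ λ j → 0 < j × nth (row X j) c ≡ just v
in-column-below-top c []      ()
in-column-below-top c (r ∷ X) v∈ r≢v with nth r c
... | nothing = let (i , xv) = column-cell c X v∈ in suc i , s≤s z≤n , xv
... | just _ with v∈
...   | here refl = ⊥-elim (r≢v refl)
...   | there v∈′ = let (i , xv) = column-cell c X v∈′ in suc i , s≤s z≤n , xv

column-tail-↭ : ∀ c x X z Z → nth x c ≡ nth z c →
                column (x ∷ X) c ↭ column (z ∷ Z) c → column X c ↭ column Z c
column-tail-↭ c x X z Z x≡z p with nth z c
... | nothing rewrite column-∷-nothing c x X x≡z = p
... | just u  rewrite column-∷-just c x X x≡z = drop-∷ p

reappears-below : ∀ c {v} j X Z → (∀ i → i < j → SameCell X Z c i) →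
                  column X c ↭ column Z c →
                  nth (row X j) c ≡ just v → nth (row Z j) c ≢ just v →
                  ∃ λ j′ → j < j′ × nth (row Z j′) c ≡ just v
reappears-below c zero X Z _ p xv z≢v =
  in-column-below-top c Z (∈-resp-↭ p (cell-in-column c 0 X xv)) z≢v
reappears-below c (suc j) []      Z _ _ ()
reappears-below c (suc j) (x ∷ X) [] _ p xv _ =
  ⊥-elim (¬Any[] (∈-resp-↭ p (cell-in-column c (suc j) (x ∷ X) xv)))
reappears-below c (suc j) (x ∷ X) (z ∷ Z) above p xv z≢v
  with reappears-below c j X Z (λ i i<j → above (suc i) (s≤s i<j))
         (column-tail-↭ c x X z Z (above 0 (s≤s z≤n)) p) xv z≢v
... | j′ , j<j′ , zv = suc j′ , s≤s j<j′ , zv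

All-row : ∀ {P : List ℕ → Set} X i → P [] → All P X → P (row X i)
All-row []      i       p[] []         = p[]
All-row (_ ∷ X) zero    _   (pr ∷ _)   = pr
All-row (_ ∷ X) (suc i) p[] (_ ∷ prs)  = All-row X i p[] prs

All-cell : ∀ {P : ℕ → Set} r c {v} → All P r → nth r c ≡ just v → P v
All-cell []      c       []         ()
All-cell (_ ∷ r) zero    (px ∷ _)   refl = px
All-cell (_ ∷ r) (suc c) (_ ∷ pxs)  rv   = All-cell r c pxs rv

cell-row-bound : ∀ X i c {v} → nth (row X i) c ≡ just v → i < length X
cell-row-bound []      i       c ()
cell-row-bound (_ ∷ X) zero    c _  = s≤s z≤n
cell-row-bound (_ ∷ X) (suc i) c xv = s≤s (cell-row-bound X i c xv)

strict-left-neighbour : ∀ r k {v} → AllPairs _>_ r → nth r (suc k) ≡ just v →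
                        ∃ λ a → nth r k ≡ just a × v < a
strict-left-neighbour []          k       _                     ()
strict-left-neighbour (_ ∷ [])    k       _                     ()
strict-left-neighbour (x ∷ y ∷ r) zero    ((x>y ∷ _) ∷ _)       refl = x , refl , x>y
strict-left-neighbour (x ∷ y ∷ r) (suc k) (_ ∷ decreasing)      rv   =
  strict-left-neighbour (y ∷ r) k decreasing rv

row-has-head : ∀ X i → All NonEmptyRow X → i < length X → ∃ λ w → nth (row X i) 0 ≡ just w
row-has-head ([] ∷ X)      zero    (() ∷ _) _
row-has-head ((w ∷ _) ∷ X) zero    _        _         = w , refl
row-has-head (_ ∷ X)       (suc i) (_ ∷ ne) (s≤s i<) = row-has-head X i ne i<

All-head : ∀ {P : ℕ → Set} X i {v} → All P (map headOr0 X) → nth (row X i) 0 ≡ just v → P v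
All-head []            i       _          ()
All-head ([] ∷ X)      zero    _          ()
All-head ((_ ∷ _) ∷ X) zero    (pv ∷ _)   refl = pv
All-head (_ ∷ X)       (suc i) (_ ∷ pvs)  xv   = All-head X i pvs xv

first-column-monotone : ∀ X {i i′ w v} → AllPairs _≤_ (map headOr0 X) → i < i′ →
                        nth (row X i) 0 ≡ just w → nth (row X i′) 0 ≡ just v → w ≤ v
first-column-monotone []            _                      _          ()
first-column-monotone ([] ∷ X)      {zero}  {suc _} _      _          ()
first-column-monotone ((_ ∷ _) ∷ X) {zero}  {suc i′} (w≤ ∷ _) _       refl xv =
  All-head X i′ w≤ xv
first-column-monotone (_ ∷ X)       {suc i} {suc i′} (_ ∷ mono) (s≤s i<i′) xw xv =
  first-column-monotone X mono i<i′ xw xv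

-- No overshoot in the first column: v reappears lower in Z, so row j of Z
-- exists and has a first cell w < v, which in turn reappears lower in X,
-- contradicting the weakly increasing first column of X.
first-column-no-overshoot : ∀ {X Z} → All NonEmptyRow Z → AllPairs _≤_ (map headOr0 X) →
                            column X 0 ↭ column Z 0 → ∀ j → NoOvershoot X Z 0 j
first-column-no-overshoot {X} {Z} neZ monoX p j above v xv below =
  let (j′ , j<j′ , zv) = reappears-below 0 j X Z above p xv (below-≢ below)
      (w , zw)         = row-has-head Z j neZ (<-trans j<j′ (cell-row-bound Z j′ 0 zv))
      w<v              = below-just zw below
      (i′ , j<i′ , xw) = reappears-below 0 j Z X (λ i i<j → sym (above i i<j)) (↭-sym p) zw
                           (λ xw → <⇒≢ w<v (just-injective (trans (sym xw) xv)))
  in <⇒≱ w<v (first-column-monotone X monoX j<i′ xv xw)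

-- No overshoot in column k+1 once column k agrees: v reappears at (j′,k+1)
-- of Z with j′ > j, and Z(j,k+1) < v, so the triple rule gives Z(j,k) ≤ v;
-- but Z(j,k) = X(j,k) > v by strictness of row j of X.
later-column-no-overshoot : ∀ {n X Z} k → IsRSCT n X → IsRSCT n Z →
                            column X (suc k) ↭ column Z (suc k) → SameColumn X Z k →
                            ∀ j → NoOvershoot X Z (suc k) j
later-column-no-overshoot {n} {X} {Z} k RX RZ p sameₖ j above v xv below
  with reappears-below (suc k) j X Z above p xv (below-≢ below)
     | strict-left-neighbour (row X j) k (All-row X j [] (IsRSCT.rowStrict RX)) xv
... | j′ , j<j′ , zv | a , xa , v<a = <⇒≱ v<Zjk Zjk≤v
  where
    1≤v : 1 ≤ v
    1≤v = proj₁ (All-cell (row X j) (suc k) (All-row X j [] (IsRSCT.inRange RX)) xv)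

    Zj′≡v : entry Z j′ (suc k) ≡ v
    Zj′≡v = cong orZero zv

    Zjk≤v : entry Z j k ≤ v
    Zjk≤v = subst (entry Z j k ≤_) Zj′≡v
      (IsRSCT.triple RZ j j′ k j<j′ (cell-row-bound Z j′ (suc k) zv)
        (subst (entry Z j (suc k) <_) (sym Zj′≡v) (below-orZero 1≤v below)))

    v<Zjk : v < entry Z j k
    v<Zjk = subst (v <_) (cong orZero (trans (sym xa) (sameₖ j))) v<a

cells-agree : ∀ {a b : Maybe ℕ} → (∀ v → a ≡ just v → Below b v → ⊥) →
              (∀ v → b ≡ just v → Below a v → ⊥) → a ≡ b
cells-agree {nothing} {nothing} _ _ = refl
cells-agree {nothing} {just w}  _ b↛ = ⊥-elim (b↛ w refl tt)
cells-agree {just v}  {nothing} a↛ _ = ⊥-elim (a↛ v refl tt)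
cells-agree {just v}  {just w}  a↛ b↛ with <-cmp v w
... | tri< v<w _ _ = ⊥-elim (b↛ w refl v<w)
... | tri≈ _ v≡w _ = cong just v≡w
... | tri> _ _ w<v = ⊥-elim (a↛ v refl w<v)

column-agrees : ∀ X Z c → (∀ j → NoOvershoot X Z c j) → (∀ j → NoOvershoot Z X c j) →
                SameColumn X Z c
column-agrees X Z c X↛Z Z↛X = <-rec (SameCell X Z c) λ j above →
  cells-agree (X↛Z j (λ i i<j → above i<j))
              (Z↛X j (λ i i<j → sym (above i<j)))

row-ext : ∀ r s → (∀ c → nth r c ≡ nth s c) → r ≡ s
row-ext []      []      _    = refl
row-ext []      (_ ∷ _) same with same 0
... | ()
row-ext (_ ∷ _) []      same with same 0
... | ()
row-ext (x ∷ r) (y ∷ s) same =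
  cong₂ _∷_ (just-injective (same 0)) (row-ext r s (λ c → same (suc c)))

filling-ext : ∀ Y W → All NonEmptyRow Y → All NonEmptyRow W → (∀ i → row Y i ≡ row W i) → Y ≡ W
filling-ext []      []      _          _          _    = refl
filling-ext []      (_ ∷ _) _          (neW ∷ _)  same = ⊥-elim (subst NonEmptyRow (sym (same 0)) neW)
filling-ext (_ ∷ _) []      (neY ∷ _)  _          same = ⊥-elim (subst NonEmptyRow (same 0) neY)
filling-ext (y ∷ Y) (w ∷ W) (_ ∷ neY)  (_ ∷ neW)  same =
  cong₂ _∷_ (same 0) (filling-ext Y W neY neW (λ i → same (suc i)))

lemma3p3 : (n : ℕ) (Y W : Filling) → IsRSCT n Y → IsRSCT n W →
           (∀ (c : ℕ) → column Y c ↭ column W c) → Y ≡ W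
lemma3p3 n Y W RY RW perm =
  filling-ext Y W (IsRSCT.nonempty RY) (IsRSCT.nonempty RW)
    (λ i → row-ext (row Y i) (row W i) (λ c → sameColumn c i))
  where
    open IsRSCT

    sameColumn : ∀ c → SameColumn Y W c
    sameColumn zero = column-agrees Y W 0
      (first-column-no-overshoot (nonempty RW) (firstCol RY) (perm 0))
      (first-column-no-overshoot (nonempty RY) (firstCol RW) (↭-sym (perm 0)))
    sameColumn (suc k) = column-agrees Y W (suc k)
      (later-column-no-overshoot k RY RW (perm (suc k)) (sameColumn k))
      (later-column-no-overshoot k RW RY (↭-sym (perm (suc k))) (λ i → sym (sameColumn k i)))
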